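{- Let $c\in\mathbb N^m$ and let $M$ be a proper $c$-multicomplex. If $Z$ is a chordless cycle in the Murai sphere $\mathrm{Bier}_c(M)$, then the length of $Z$ is at most $m+3$.
   Context: Here $c=(c_1,\ldots,c_m)$ with all $c_i\ge1$ integers. A $c$-monomial is $x^a=x_1^{a_1}\cdots x_m^{a_m}$ with $0\le a_i\le c_i$. A $c$-multicomplex is a nonempty set $M$ of $c$-monomials closed under taking divisors; proper means it is not the set of all $c$-monomials. Let $\tilde X=\{x_i^{(j)}: 1\le i\le m,\ 0\le j\le c_i\}$. For a $c$-monomial $x^a$, $1\le i\le m$, $a_i<j\le c_i$, put $G(x^a;x_i^j)=\tilde X\setminus\{x_1^{(a_1)},\ldots,x_m^{(a_m)},x_i^{(j)}\}$ and let $x^a\diamond x_i^j$ be obtained from $x^a$ by replacing $a_i$ by $j$. The Murai sphere $\mathrm{Bier}_c(M)$ is the simplicial complex on $\tilde X$ whose facets are the sets $G(x^a;x_i^j)$ with $x^a\in M$, $a_i<j\le c_i$, $x^a\diamond x_i^j\notin M$. A chordless cycle in a simplicial complex is a cycle of length at least $4$ in its 1-skeleton which is an induced subgraph (no edge of the 1-skeleton joins two non-consecutive vertices of the cycle). -}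

module Defs where

open import Data.Nat using (ℕ; zero; suc; _≤_; _<_)
open import Data.Fin as Fin using (Fin; toℕ)
open import Data.Product using (Σ; _×_; _,_; ∃; ∃-syntax)
open import Data.Sum using (_⊎_)
open import Relation.Nullary using (¬_; yes; no)
open import Relation.Binary.PropositionalEquality using (_≡_; _≢_; refl)
open import Level using (0ℓ) renaming (suc to lsuc)

Mono : {m : ℕ} → (Fin m → ℕ) → Set
Mono {m} c = (i : Fin m) → Fin (suc (c i))

_∣ₘ_ : {m : ℕ} {c : Fin m → ℕ} → Mono c → Mono c → Set
_∣ₘ_ {m} a b = (i : Fin m) → toℕ (a i) ≤ toℕ (b i)

record Multicomplex {m : ℕ} (c : Fin m → ℕ) : Set₁ where
  field
    mem      : Mono c → Set
    nonempty : ∃[ a ] mem a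
    closed   : (a b : Mono c) → a ∣ₘ b → mem b → mem a

open Multicomplex public

Proper : {m : ℕ} {c : Fin m → ℕ} → Multicomplex c → Set
Proper {c = c} M = ∃[ a ] ¬ mem M a

_⋄_ : {m : ℕ} {c : Fin m → ℕ} → Mono c → Σ (Fin m) (λ i → Fin (suc (c i))) → Mono c
(a ⋄ (i , j)) p with p Fin.≟ i
... | yes refl = j
... | no _ = a p

Vertex : {m : ℕ} → (Fin m → ℕ) → Set
Vertex {m} c = Σ (Fin m) (λ i → Fin (suc (c i)))

InG : {m : ℕ} {c : Fin m → ℕ} → Mono c → Vertex c → Vertex c → Set
InG a ij (p , q) = (q ≢ a p) × ((p , q) ≢ ij)

-- F is (the indicator of) a facet of Bier_c(M): F = G(x^a;x_i^j) with
-- x^a ∈ M, a_i < j ≤ c_i, x^a ⋄ x_i^j ∉ M.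
-- We express "the set of vertices v is contained in some facet".
InSomeFacet : {m : ℕ} {c : Fin m → ℕ} → Multicomplex c → (Vertex c → Set) → Set
InSomeFacet {c = c} M S =
  Σ (Mono c) λ a → Σ (Vertex c) λ ij →
    mem M a × (toℕ (a (Data.Product.proj₁ ij)) < toℕ (Data.Product.proj₂ ij))
    × ¬ mem M (a ⋄ ij)
    × ((v : Vertex c) → S v → InG a ij v)

Adjacent : {m : ℕ} {c : Fin m → ℕ} → Multicomplex c → Vertex c → Vertex c → Set
Adjacent M u v = (u ≢ v) × InSomeFacet M (λ w → (w ≡ u) ⊎ (w ≡ v))

Consec : (k : ℕ) → Fin k → Fin k → Set
Consec k i j = (suc (toℕ i) ≡ toℕ j) ⊎ ((suc (toℕ i) ≡ k) × (toℕ j ≡ 0))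

record ChordlessCycle {m : ℕ} {c : Fin m → ℕ} (M : Multicomplex c) (k : ℕ) : Set where
  field
    len≥4      : 4 ≤ k
    vtx        : Fin k → Vertex c
    injective  : (i j : Fin k) → vtx i ≡ vtx j → i ≡ j
    edges      : (i j : Fin k) → Consec k i j → Adjacent M (vtx i) (vtx j)
    chordless  : (i j : Fin k) → i ≢ j → ¬ Consec k i j → ¬ Consec k j i →
                 ¬ Adjacent M (vtx i) (vtx j)

-- A facet G(x^a; x_i^j) misses only the m + 1 vertices x_1^(a_1), …, x_m^(a_m), x_i^(j).
-- Take the facet containing two consecutive vertices Z_0, Z_1 of a chordless cycle of
-- length k. Any other Z_t lying in it would be adjacent to both Z_0 and Z_1, while for
-- k ≥ 4 it is non-consecutive to at least one of them; so the remaining k − 2 vertices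
-- all lie outside the facet, and k − 2 ≤ m + 1.
module Submission where

open import Defs
open import Data.Nat using (ℕ; _≤_; _+_)
open import Data.Fin using (Fin)
open import Data.Nat using (zero; suc; s≤s; _<_)
open import Data.Fin using (toℕ)
open import Data.Fin.Properties using (_≟_; suc-injective; injective⇒≤)
open import Data.Nat.Properties using (+-comm)
import Data.Nat.Properties as ℕ
open import Data.Product using (_,_; proj₁; proj₂)
open import Data.Product.Properties using (≡-dec)
open import Data.Sum using (_⊎_; inj₁; inj₂)
open import Function using (_∘_)
open import Relation.Nullary using (¬_; Dec; yes; no)
open import Relation.Nullary.Decidable using (decidable-stable)
open import Relation.Binary.PropositionalEquality using (_≡_; _≢_; refl; sym; trans; cong; subst)

module _ {m : ℕ} {c : Fin m → ℕ} where

  _≟ᵥ_ : (u v : Vertex c) → Dec (u ≡ v)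
  _≟ᵥ_ = ≡-dec _≟_ _≟_

  ∉G⇒≡ : (a : Mono c) (ij : Vertex c) {p : Fin m} {q : Fin (suc (c p))} →
         ¬ InG a ij (p , q) → q ≢ a p → (p , q) ≡ ij
  ∉G⇒≡ a ij v∉ q≢ = decidable-stable (_ ≟ᵥ ij) (λ v≢ij → v∉ (q≢ , v≢ij))

  complementIndex : Mono c → Vertex c → Fin (suc m)
  complementIndex a (p , q) with q ≟ a p
  ... | yes _ = Fin.suc p
  ... | no _  = Fin.zero

  complementIndex-injective : (a : Mono c) (ij : Vertex c) {u v : Vertex c} →
    ¬ InG a ij u → ¬ InG a ij v → complementIndex a u ≡ complementIndex a v → u ≡ v
  complementIndex-injective a ij {p , q} {p′ , q′} u∉ v∉ eq with q ≟ a p | q′ ≟ a p′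
  ... | yes q≡ | yes q′≡ with refl ← suc-injective eq = cong (p ,_) (trans q≡ (sym q′≡))
  ... | no q≢  | no q′≢  = trans (∉G⇒≡ a ij u∉ q≢) (sym (∉G⇒≡ a ij v∉ q′≢))

  record IsFacet (M : Multicomplex c) (a : Mono c) (ij : Vertex c) : Set where
    constructor facet
    field
      a∈M     : mem M a
      aᵢ<j    : toℕ (a (proj₁ ij)) < toℕ (proj₂ ij)
      a⋄ij∉M  : ¬ mem M (a ⋄ ij)

  adjacent-within-facet : {M : Multicomplex c} {a : Mono c} {ij u v : Vertex c} →
    IsFacet M a ij → u ≢ v → InG a ij u → InG a ij v → Adjacent M u v
  adjacent-within-facet {a = a} {ij} (facet a∈M a<j a⋄ij∉M) u≢v u∈G v∈G =
    u≢v , (a , ij , a∈M , a<j , a⋄ij∉M , λ where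
      _ (inj₁ refl) → u∈G
      _ (inj₂ refl) → v∈G)

  outside-G-≤ : (a : Mono c) (ij : Vertex c) {n : ℕ} (f : Fin n → Vertex c) →
    (∀ {s t} → f s ≡ f t → s ≡ t) → (∀ t → ¬ InG a ij (f t)) → n ≤ suc m
  outside-G-≤ a ij f f-injective f∉G =
    injective⇒≤ {f = complementIndex a ∘ f}
      (f-injective ∘ complementIndex-injective a ij (f∉G _) (f∉G _))

module _ {n : ℕ} (t : Fin n) where

  private
    k = suc (suc n)
    s = Fin.suc (Fin.suc t)

  ¬Consec-0-ss : ¬ Consec k Fin.zero s
  ¬Consec-0-ss (inj₁ ())
  ¬Consec-0-ss (inj₂ (() , _))

  ¬Consec-ss-0 : suc (toℕ s) ≢ k → ¬ Consec k s Fin.zero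
  ¬Consec-ss-0 s≢last (inj₂ (s≡last , _)) = s≢last s≡last

  ¬Consec-1-ss : 4 ≤ k → suc (toℕ s) ≡ k → ¬ Consec k (Fin.suc Fin.zero) s
  ¬Consec-1-ss 4≤k s≡last (inj₁ 2≡s)
    with s≤s (s≤s (s≤s ())) ← subst (λ x → 4 ≤ 3 + x) (sym (ℕ.suc-injective (ℕ.suc-injective 2≡s)))
                (subst (4 ≤_) (sym s≡last) 4≤k)
  ¬Consec-1-ss 4≤k _      (inj₂ (2≡k , _)) with s≤s (s≤s ()) ← subst (4 ≤_) (sym 2≡k) 4≤k

  ¬Consec-ss-1 : ¬ Consec k s (Fin.suc Fin.zero)
  ¬Consec-ss-1 (inj₂ (_ , ()))

module _ {m : ℕ} {c : Fin m → ℕ} {M : Multicomplex c} {n : ℕ}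
         (Z : ChordlessCycle M (suc (suc n))) where

  open ChordlessCycle Z

  vtx-≢ : {i j : Fin (suc (suc n))} → i ≢ j → vtx i ≢ vtx j
  vtx-≢ i≢j = i≢j ∘ injective _ _

  -- For the last vertex Z_{k-1} the chord to Z_0 is an edge, so the one to Z_1 is used.
  facet-through-edge-avoids-rest : {a : Mono c} {ij : Vertex c} → IsFacet M a ij →
    InG a ij (vtx Fin.zero) → InG a ij (vtx (Fin.suc Fin.zero)) →
    (t : Fin n) → ¬ InG a ij (vtx (Fin.suc (Fin.suc t)))
  facet-through-edge-avoids-rest isFacet Z₀∈G Z₁∈G t Zₜ∈G
    with suc (toℕ (Fin.suc (Fin.suc t))) ℕ.≟ suc (suc n)
  ... | no t≢last  = chordless _ _ (λ ()) (¬Consec-0-ss t) (¬Consec-ss-0 t t≢last)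
                       (adjacent-within-facet isFacet (vtx-≢ λ ()) Z₀∈G Zₜ∈G)
  ... | yes t≡last = chordless _ _ (λ ()) (¬Consec-1-ss t len≥4 t≡last) (¬Consec-ss-1 t)
                       (adjacent-within-facet isFacet (vtx-≢ λ ()) Z₁∈G Zₜ∈G)

  chordlessCycle-length≤ : n ≤ suc m
  chordlessCycle-length≤ with edges Fin.zero (Fin.suc Fin.zero) (inj₁ refl)
  ... | _ , a , ij , a∈M , a<j , a⋄ij∉M , edge⊆G =
    outside-G-≤ a ij (vtx ∘ Fin.suc ∘ Fin.suc) (suc-injective ∘ suc-injective ∘ injective _ _)
      (facet-through-edge-avoids-rest (facet a∈M a<j a⋄ij∉M) (edge⊆G _ (inj₁ refl)) (edge⊆G _ (inj₂ refl)))

mainTheorem4 : (m : ℕ) (c : Fin m → ℕ) → ((i : Fin m) → 1 ≤ c i) →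
               (M : Multicomplex c) → Proper M →
               (k : ℕ) → ChordlessCycle M k → k ≤ m + 3
mainTheorem4 m c _ M _ (suc (suc n)) Z =
  subst (suc (suc n) ≤_) (+-comm 3 m) (s≤s (s≤s (chordlessCycle-length≤ Z)))
mainTheorem4 m c _ M _ zero          Z with () ← ChordlessCycle.len≥4 Z
mainTheorem4 m c _ M _ (suc zero)    Z with s≤s () ← ChordlessCycle.len≥4 Z
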